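{- Let $\Gamma\in\mathcal{C}$, $v\in\mathcal{U}_C$, $\varphi\in\mathcal{T}_{NF}$. (1) $\langle v.\Gamma\rangle\Rightarrow\varphi$ is closed iff $\langle\Gamma\rangle\Rightarrow v\to\varphi$ is closed. (2) $\langle nil\rangle\Rightarrow\varphi$ is closed iff $\langle nil\rangle\Rightarrow\omega\to\varphi$ is closed. (3) Let $n\in\mathbb{N}^*$, let $m\ge0$, and for $1\le i\le m$ let $T_i=\langle\Gamma^i\rangle\Rightarrow\varphi_i$ (with $\Gamma^i\in\mathcal{C}$, $\varphi_i\in\mathcal{T}_{NF}$) be closed $\mathcal{C}$-types whose sets $TV(T_i)$ are pairwise disjoint. Then for any type variable $\alpha$ not occurring in any $T_i$, the $\mathcal{C}$-type $\langle(\omega^{n-1}.(\varphi_1\to\cdots\to\varphi_m\to\alpha).nil)\wedge\Gamma^1\wedge\cdots\wedge\Gamma^m\rangle\Rightarrow\alpha$ is closed.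
   Context: Types: $\mathcal{A}$ is a denumerable set of type variables; $\tau\in\mathcal{T}::=\alpha\mid u\to\tau$, $u\in\mathcal{U}::=\omega\mid u\wedge u\mid\tau$, with $\wedge$ commutative, associative, neutral element $\omega$; $\to$ associates to the right. Contexts: $\Gamma::=nil\mid u.\Gamma$; $\omega^{k}.\Gamma$ is $\Gamma$ prefixed by $k$ copies of $\omega$; $nil\wedge\Gamma=\Gamma\wedge nil=\Gamma$, $(u_1.\Gamma)\wedge(u_2.\Delta)=(u_1\wedge u_2).(\Gamma\wedge\Delta)$. Subsets: $\rho\in\mathcal{T}_C::=\alpha\mid\varphi\to\rho$ ($\varphi\in\mathcal{T}_{NF}$); $\varphi\in\mathcal{T}_{NF}::=\alpha\mid v\to\varphi$ ($v\in\mathcal{U}_C$); $v\in\mathcal{U}_C::=\omega\mid v\wedge v\mid\rho$ ($\rho\in\mathcal{T}_C$); $\mathcal{C}$ is the set of contexts with all elements in $\mathcal{U}_C$ (closed under $\wedge$). A $\mathcal{C}$-type is either $\langle\Gamma\rangle\Rightarrow\varphi$ with $\Gamma\in\mathcal{C}$, $\varphi\in\mathcal{T}_{NF}$, or $\langle\Delta\rangle\Rightarrow$ with $\Delta\in\mathcal{C}$, $|\Delta|>0$. $TV(\cdot)$ is the set of type variables occurring. Polarity of occurrences of type variables: in $\alpha$ the occurrence is positive; in $u\to\tau$ occurrences in $\tau$ keep their sign and occurrences in $u$ have their sign reversed; in $u\wedge u'$ signs are kept; in a context, occurrences have the sign they have in the element they belong to; in a $\mathcal{C}$-type $\langle\Gamma\rangle\Rightarrow\varphi$,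 occurrences in $\varphi$ keep their sign and occurrences in $\Gamma$ have their sign reversed. A $\mathcal{C}$-type $T$ is closed if every $\alpha\in TV(T)$ has exactly one positive and exactly one negative occurrence in $T$ (and no others). -}

module Defs where

open import Data.Nat using (ℕ; zero; suc; _+_; _≤_; _≡ᵇ_)
open import Data.Bool using (if_then_else_)
open import Data.List using (List; []; _∷_; foldr; foldl; tabulate; replicate; _++_)
open import Data.List.Relation.Unary.All using (All)
open import Data.Product using (_×_)
open import Relation.Binary.PropositionalEquality using (_≡_)

TVar : Set
TVar = ℕ

-- Syntax of types τ ∈ 𝒯 and u ∈ 𝒰 (as raw trees; ∧ is AC with unit ω
-- in the paper; all notions below (occurrence counts, closedness) are
-- invariant under those equations, so no quotient is needed).
infixr 5 _⇒_
infixl 6 _∧_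
mutual
  data Ty : Set where
    var : TVar → Ty
    _⇒_ : Un → Ty → Ty

  data Un : Set where
    ω   : Un
    _∧_ : Un → Un → Un
    ty  : Ty → Un

mutual
  data IsTC : Ty → Set where
    var : (α : TVar) → IsTC (var α)
    arr : ∀ {φ ρ} → IsNF φ → IsTC ρ → IsTC (ty φ ⇒ ρ)

  data IsNF : Ty → Set where
    var : (α : TVar) → IsNF (var α)
    arr : ∀ {v φ} → IsUC v → IsNF φ → IsNF (v ⇒ φ)

  data IsUC : Un → Set where
    ω   : IsUC ω
    _∧_ : ∀ {v w} → IsUC v → IsUC w → IsUC (v ∧ w)
    ty  : ∀ {ρ} → IsTC ρ → IsUC (ty ρ)

Ctx : Set
Ctx = List Un

InC : Ctx → Set
InC Γ = All IsUC Γ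

ω^_∙_ : ℕ → Ctx → Ctx
ω^ k ∙ Γ = replicate k ω ++ Γ

infixl 6 _∧ᶜ_
_∧ᶜ_ : Ctx → Ctx → Ctx
[]      ∧ᶜ Δ       = Δ
(u ∷ Γ) ∧ᶜ []      = u ∷ Γ
(u ∷ Γ) ∧ᶜ (v ∷ Δ) = (u ∧ v) ∷ (Γ ∧ᶜ Δ)

data CType : Set where
  ⟨_⟩⇒_ : Ctx → Ty → CType
  ⟨_⟩⇒∅ : Ctx → CType

mutual
  posT : TVar → Ty → ℕ
  posT α (var β) = if α ≡ᵇ β then 1 else 0
  posT α (u ⇒ τ) = negU α u + posT α τ

  negT : TVar → Ty → ℕ
  negT α (var β) = 0
  negT α (u ⇒ τ) = posU α u + negT α τ

  posU : TVar → Un → ℕ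
  posU α ω       = 0
  posU α (u ∧ w) = posU α u + posU α w
  posU α (ty τ)  = posT α τ

  negU : TVar → Un → ℕ
  negU α ω       = 0
  negU α (u ∧ w) = negU α u + negU α w
  negU α (ty τ)  = negT α τ

posCtx : TVar → Ctx → ℕ
posCtx α []      = 0
posCtx α (u ∷ Γ) = posU α u + posCtx α Γ

negCtx : TVar → Ctx → ℕ
negCtx α []      = 0
negCtx α (u ∷ Γ) = negU α u + negCtx α Γ

posCT : TVar → CType → ℕ
posCT α (⟨ Γ ⟩⇒ φ) = negCtx α Γ + posT α φ
posCT α ⟨ Δ ⟩⇒∅    = negCtx α Δ

negCT : TVar → CType → ℕ
negCT α (⟨ Γ ⟩⇒ φ) = posCtx α Γ + negT α φ
negCT α ⟨ Δ ⟩⇒∅    = posCtx α Δ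

_∈TV_ : TVar → CType → Set
α ∈TV T = 1 ≤ posCT α T + negCT α T

Closed : CType → Set
Closed T = ∀ α → α ∈TV T → (posCT α T ≡ 1) × (negCT α T ≡ 1)

arrows : List Ty → Ty → Ty
arrows φs τ = foldr (λ φ acc → ty φ ⇒ acc) τ φs

meetAll : Ctx → List Ctx → Ctx
meetAll Γ Γs = foldl _∧ᶜ_ Γ Γs

-- Closedness of a 𝒞-type only depends on how many positive and negative
-- occurrences each variable has, and every construction in the statement
-- acts additively on these counts. Moving v from the context to the left of
-- the arrow leaves both polarities of each occurrence unchanged, and ω
-- contributes nothing. In ⟨(ω^k.(φ₁→⋯→φₘ→α)) ∧ Γ¹ ∧ ⋯ ∧ Γᵐ⟩⇒α the counts of
-- a variable β are the sums of its counts in the Tᵢ, plus one of each sign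
-- when β = α. Since the Tᵢ have disjoint variables, every β ≠ α occurring at
-- all occurs in exactly one Tᵢ, hence once with each sign; and α, absent from
-- every Tᵢ, occurs exactly twice, once with each sign.
module Submission where

open import Defs
open import Data.Nat using (ℕ; zero; suc; _+_; _≤_; _∸_; _≡ᵇ_; _≟_)
open import Data.Nat.Properties
  using (+-identityʳ; +-comm; +-assoc; +-commutativeSemigroup; +-0-commutativeMonoid;
         m+n≡0⇒m≡0; m+n≡0⇒n≡0; n≢0⇒n>0; n≮0; ≮⇒≥; n≤0⇒n≡0; ≡ᵇ⇒≡)
open import Algebra.Properties.CommutativeSemigroup +-commutativeSemigroup
  using (interchange; xy∙z≈y∙xz; xy∙z≈zx∙y)
open import Algebra.Properties.CommutativeMonoid.Sum +-0-commutativeMonoid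
  using (sum; sum-syntax; ∑-distrib-+; sum-remove; sum-cong-≗; sum-replicate-zero)
open import Data.Bool using (true; false; T)
open import Data.Unit using (tt)
open import Data.Fin as Fin using (Fin; punchIn)
open import Data.Fin.Properties using (punchInᵢ≢i; ¬∀⟶∃¬)
open import Data.List using ([]; _∷_; tabulate)
open import Data.Product using (_×_; _,_; ∃; proj₁; proj₂; map₂)
open import Function using (id; _∘_)
open import Function.Bundles using (_⇔_; mk⇔)
open import Relation.Nullary using (¬_)
open import Relation.Binary.PropositionalEquality
open ≡-Reasoning

-- Closed T unfolds to ∀ α → Linear (posCT α T) (negCT α T).
Linear : ℕ → ℕ → Set
Linear p q = 1 ≤ p + q → p ≡ 1 × q ≡ 1

Closed-resp : ∀ S T → (∀ α → posCT α S ≡ posCT α T) → (∀ α → negCT α S ≡ negCT α T) →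
              Closed S → Closed T
Closed-resp S T pos≡ neg≡ closed α = subst₂ Linear (pos≡ α) (neg≡ α) (closed α)

¬1≤m+n⇒m≡0×n≡0 : ∀ {m n} → ¬ (1 ≤ m + n) → m ≡ 0 × n ≡ 0
¬1≤m+n⇒m≡0×n≡0 {m} {n} ¬1≤m+n = m+n≡0⇒m≡0 m m+n≡0 , m+n≡0⇒n≡0 m m+n≡0
  where
  m+n≡0 : m + n ≡ 0
  m+n≡0 = n≤0⇒n≡0 (≮⇒≥ ¬1≤m+n)

∑-zero : ∀ {m} (f : Fin m → ℕ) → (∀ i → f i ≡ 0) → ∑[ i < m ] f i ≡ 0
∑-zero {m} f f≡0 = trans (sum-cong-≗ f≡0) (sum-replicate-zero m)

∑-concentrated : ∀ {m} (f : Fin m → ℕ) (i : Fin m) → (∀ j → j ≢ i → f j ≡ 0) →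
                 ∑[ j < m ] f j ≡ f i
∑-concentrated {suc m} f i f≡0 = begin
  sum f                        ≡⟨ sum-remove {i = i} f ⟩
  f i + sum (f ∘ punchIn i)    ≡⟨ cong (f i +_) (∑-zero _ (λ j → f≡0 _ (punchInᵢ≢i i j))) ⟩
  f i + 0                      ≡⟨ +-identityʳ (f i) ⟩
  f i                          ∎

∑-positive : ∀ {m} (f : Fin m → ℕ) → 1 ≤ ∑[ i < m ] f i → ∃ λ i → 1 ≤ f i
∑-positive {m} f 1≤∑f = map₂ n≢0⇒n>0 (¬∀⟶∃¬ m (λ i → f i ≡ 0) (λ i → f i ≟ 0) not-all-zero)
  where
  not-all-zero : ¬ (∀ i → f i ≡ 0)
  not-all-zero f≡0 = n≮0 (subst (1 ≤_) (∑-zero f f≡0) 1≤∑f)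

∑-Linear : ∀ {m} (p q : Fin m → ℕ) → (∀ i → Linear (p i) (q i)) →
           (∀ i j → i ≢ j → ¬ (1 ≤ p i + q i × 1 ≤ p j + q j)) →
           Linear (∑[ i < m ] p i) (∑[ i < m ] q i)
∑-Linear p q linear disjoint 1≤∑p+∑q
  with i , 1≤pi+qi ← ∑-positive (λ i → p i + q i) (subst (1 ≤_) (sym (∑-distrib-+ p q)) 1≤∑p+∑q)
  with pi≡1 , qi≡1 ← linear i 1≤pi+qi
  = trans (∑-concentrated p i (λ j → proj₁ ∘ absent j)) pi≡1
  , trans (∑-concentrated q i (λ j → proj₂ ∘ absent j)) qi≡1
  where
  absent : ∀ j → j ≢ i → p j ≡ 0 × q j ≡ 0
  absent j j≢i = ¬1≤m+n⇒m≡0×n≡0 (λ 1≤pj+qj → disjoint j i j≢i (1≤pj+qj , 1≤pi+qi))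

module AdditiveCount (weight : Un → ℕ) (count : Ctx → ℕ)
  (weight-ω : weight ω ≡ 0)
  (weight-∧ : ∀ u w → weight (u ∧ w) ≡ weight u + weight w)
  (count-[] : count [] ≡ 0)
  (count-∷ : ∀ u Γ → count (u ∷ Γ) ≡ weight u + count Γ) where

  count-ω^ : ∀ k Γ → count (ω^ k ∙ Γ) ≡ count Γ
  count-ω^ zero    Γ = refl
  count-ω^ (suc k) Γ = begin
    count (ω ∷ ω^ k ∙ Γ)       ≡⟨ count-∷ ω (ω^ k ∙ Γ) ⟩
    weight ω + count (ω^ k ∙ Γ) ≡⟨ cong₂ _+_ weight-ω (count-ω^ k Γ) ⟩
    count Γ                     ∎

  count-∧ᶜ : ∀ Γ Δ → count (Γ ∧ᶜ Δ) ≡ count Γ + count Δ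
  count-∧ᶜ []      Δ       = cong (_+ count Δ) (sym count-[])
  count-∧ᶜ (u ∷ Γ) []      = sym (trans (cong (count (u ∷ Γ) +_) count-[]) (+-identityʳ _))
  count-∧ᶜ (u ∷ Γ) (w ∷ Δ) = begin
    count ((u ∧ w) ∷ (Γ ∧ᶜ Δ))                     ≡⟨ count-∷ (u ∧ w) (Γ ∧ᶜ Δ) ⟩
    weight (u ∧ w) + count (Γ ∧ᶜ Δ)                ≡⟨ cong₂ _+_ (weight-∧ u w) (count-∧ᶜ Γ Δ) ⟩
    (weight u + weight w) + (count Γ + count Δ)    ≡⟨ interchange (weight u) (weight w) _ _ ⟩
    (weight u + count Γ) + (weight w + count Δ)    ≡⟨ sym (cong₂ _+_ (count-∷ u Γ) (count-∷ w Δ)) ⟩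
    count (u ∷ Γ) + count (w ∷ Δ)                  ∎

  count-meetAll : ∀ {m} Γ (Γs : Fin m → Ctx) →
                  count (meetAll Γ (tabulate Γs)) ≡ count Γ + ∑[ i < m ] count (Γs i)
  count-meetAll {zero}  Γ Γs = sym (+-identityʳ (count Γ))
  count-meetAll {suc m} Γ Γs = begin
    count (meetAll (Γ ∧ᶜ Γs Fin.zero) (tabulate (Γs ∘ Fin.suc)))
      ≡⟨ count-meetAll (Γ ∧ᶜ Γs Fin.zero) (Γs ∘ Fin.suc) ⟩
    count (Γ ∧ᶜ Γs Fin.zero) + ∑[ i < m ] count (Γs (Fin.suc i))
      ≡⟨ cong (_+ ∑[ i < m ] count (Γs (Fin.suc i))) (count-∧ᶜ Γ (Γs Fin.zero)) ⟩
    count Γ + count (Γs Fin.zero) + ∑[ i < m ] count (Γs (Fin.suc i))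
      ≡⟨ +-assoc (count Γ) _ _ ⟩
    count Γ + ∑[ i < suc m ] count (Γs i)
      ∎

module PosCount α = AdditiveCount (posU α) (posCtx α) refl (λ _ _ → refl) refl (λ _ _ → refl)
module NegCount α = AdditiveCount (negU α) (negCtx α) refl (λ _ _ → refl) refl (λ _ _ → refl)

posT-arrows : ∀ {m} α (φs : Fin m → Ty) τ →
              posT α (arrows (tabulate φs) τ) ≡ ∑[ i < m ] negT α (φs i) + posT α τ
posT-arrows {zero}  α φs τ = refl
posT-arrows {suc m} α φs τ =
  trans (cong (negT α (φs Fin.zero) +_) (posT-arrows α (φs ∘ Fin.suc) τ))
        (sym (+-assoc (negT α (φs Fin.zero)) (∑[ i < m ] negT α (φs (Fin.suc i))) (posT α τ)))

negT-arrows : ∀ {m} α (φs : Fin m → Ty) τ →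
              negT α (arrows (tabulate φs) τ) ≡ ∑[ i < m ] posT α (φs i) + negT α τ
negT-arrows {zero}  α φs τ = refl
negT-arrows {suc m} α φs τ =
  trans (cong (posT α (φs Fin.zero) +_) (negT-arrows α (φs ∘ Fin.suc) τ))
        (sym (+-assoc (posT α (φs Fin.zero)) (∑[ i < m ] posT α (φs (Fin.suc i))) (negT α τ)))

closed-∷⇔closed-⇒ : ∀ Γ v φ → Closed (⟨ v ∷ Γ ⟩⇒ φ) ⇔ Closed (⟨ Γ ⟩⇒ (v ⇒ φ))
closed-∷⇔closed-⇒ Γ v φ =
  mk⇔ (Closed-resp inContext inArrow pos≡ neg≡) (Closed-resp inArrow inContext (sym ∘ pos≡) (sym ∘ neg≡))
  where
  inContext inArrow : CType
  inContext = ⟨ v ∷ Γ ⟩⇒ φ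
  inArrow = ⟨ Γ ⟩⇒ (v ⇒ φ)
  pos≡ : ∀ α → posCT α inContext ≡ posCT α inArrow
  pos≡ α = xy∙z≈y∙xz (negU α v) (negCtx α Γ) (posT α φ)
  neg≡ : ∀ α → negCT α inContext ≡ negCT α inArrow
  neg≡ α = xy∙z≈y∙xz (posU α v) (posCtx α Γ) (negT α φ)

-- The type of x_{k+1} N₁ ⋯ Nₘ, where Nᵢ has type ⟨ Γs i ⟩⇒ φs i.
appType : ∀ {m} → ℕ → (Fin m → Ctx) → (Fin m → Ty) → TVar → CType
appType k Γs φs α = ⟨ meetAll (ω^ k ∙ (ty (arrows (tabulate φs) (var α)) ∷ [])) (tabulate Γs) ⟩⇒ var α

module _ {m} (k : ℕ) (Γs : Fin m → Ctx) (φs : Fin m → Ty) (α β : TVar) where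

  private
    head : Ctx
    head = ω^ k ∙ (ty (arrows (tabulate φs) (var α)) ∷ [])
    [β≡α] : ℕ
    [β≡α] = posT β (var α)

  posCT-appType : posCT β (appType k Γs φs α) ≡ ∑[ i < m ] posCT β (⟨ Γs i ⟩⇒ φs i) + [β≡α]
  posCT-appType = cong (_+ [β≡α]) (begin
    negCtx β (meetAll head (tabulate Γs))                     ≡⟨ NegCount.count-meetAll β head Γs ⟩
    negCtx β head + ∑[ i < m ] negCtx β (Γs i)               ≡⟨ cong (_+ ∑[ i < m ] negCtx β (Γs i)) negCtx-head ⟩
    ∑[ i < m ] posT β (φs i) + ∑[ i < m ] negCtx β (Γs i)    ≡⟨ +-comm (∑[ i < m ] posT β (φs i)) _ ⟩
    ∑[ i < m ] negCtx β (Γs i) + ∑[ i < m ] posT β (φs i)    ≡⟨ sym (∑-distrib-+ (negCtx β ∘ Γs) (posT β ∘ φs)) ⟩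
    ∑[ i < m ] posCT β (⟨ Γs i ⟩⇒ φs i)                      ∎)
    where
    negCtx-head : negCtx β head ≡ ∑[ i < m ] posT β (φs i)
    negCtx-head = begin
      negCtx β head                                       ≡⟨ NegCount.count-ω^ β k _ ⟩
      negT β (arrows (tabulate φs) (var α)) + 0           ≡⟨ +-identityʳ _ ⟩
      negT β (arrows (tabulate φs) (var α))               ≡⟨ negT-arrows β φs (var α) ⟩
      ∑[ i < m ] posT β (φs i) + 0                        ≡⟨ +-identityʳ _ ⟩
      ∑[ i < m ] posT β (φs i)                            ∎

  negCT-appType : negCT β (appType k Γs φs α) ≡ ∑[ i < m ] negCT β (⟨ Γs i ⟩⇒ φs i) + [β≡α]
  negCT-appType = begin
    posCtx β (meetAll head (tabulate Γs)) + 0                          ≡⟨ +-identityʳ _ ⟩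
    posCtx β (meetAll head (tabulate Γs))                              ≡⟨ PosCount.count-meetAll β head Γs ⟩
    posCtx β head + ∑[ i < m ] posCtx β (Γs i)                        ≡⟨ cong (_+ ∑[ i < m ] posCtx β (Γs i)) posCtx-head ⟩
    ∑[ i < m ] negT β (φs i) + [β≡α] + ∑[ i < m ] posCtx β (Γs i)     ≡⟨ xy∙z≈zx∙y (∑[ i < m ] negT β (φs i)) [β≡α] _ ⟩
    ∑[ i < m ] posCtx β (Γs i) + ∑[ i < m ] negT β (φs i) + [β≡α]     ≡⟨ cong (_+ [β≡α]) (sym (∑-distrib-+ (posCtx β ∘ Γs) (negT β ∘ φs))) ⟩
    ∑[ i < m ] negCT β (⟨ Γs i ⟩⇒ φs i) + [β≡α]                       ∎
    where
    posCtx-head : posCtx β head ≡ ∑[ i < m ] negT β (φs i) + [β≡α]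
    posCtx-head = begin
      posCtx β head                                       ≡⟨ PosCount.count-ω^ β k _ ⟩
      posT β (arrows (tabulate φs) (var α)) + 0           ≡⟨ +-identityʳ _ ⟩
      posT β (arrows (tabulate φs) (var α))               ≡⟨ posT-arrows β φs (var α) ⟩
      ∑[ i < m ] negT β (φs i) + [β≡α]                    ∎

appType-closed : ∀ {m} k (Γs : Fin m → Ctx) (φs : Fin m → Ty) →
                 (∀ i → Closed (⟨ Γs i ⟩⇒ φs i)) →
                 (∀ i j → i ≢ j → ∀ β → ¬ (β ∈TV (⟨ Γs i ⟩⇒ φs i) × β ∈TV (⟨ Γs j ⟩⇒ φs j))) →
                 (α : TVar) → (∀ i → ¬ (α ∈TV (⟨ Γs i ⟩⇒ φs i))) →
                 Closed (appType k Γs φs α)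
appType-closed {m} k Γs φs closed disjoint α fresh β =
  subst₂ Linear (sym (posCT-appType k Γs φs α β)) (sym (negCT-appType k Γs φs α β)) linear
  where
  P Q : Fin m → ℕ
  P i = posCT β (⟨ Γs i ⟩⇒ φs i)
  Q i = negCT β (⟨ Γs i ⟩⇒ φs i)
  linear : Linear (∑[ i < m ] P i + posT β (var α)) (∑[ i < m ] Q i + posT β (var α))
  linear with β ≡ᵇ α in β≡ᵇα
  ... | true  = λ _ → cong (_+ 1) (∑-zero P (proj₁ ∘ absent)) , cong (_+ 1) (∑-zero Q (proj₂ ∘ absent))
    where
    absent : ∀ i → P i ≡ 0 × Q i ≡ 0
    absent i rewrite ≡ᵇ⇒≡ β α (subst T (sym β≡ᵇα) tt) = ¬1≤m+n⇒m≡0×n≡0 (fresh i)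
  ... | false = subst₂ Linear (sym (+-identityʳ _)) (sym (+-identityʳ _))
                  (∑-Linear P Q (λ i → closed i β) (λ i j i≢j → disjoint i j i≢j β))

lemma3p9 :
    ((Γ : Ctx) (v : Un) (φ : Ty) → InC Γ → IsUC v → IsNF φ →
      Closed (⟨ v ∷ Γ ⟩⇒ φ) ⇔ Closed (⟨ Γ ⟩⇒ (v ⇒ φ)))
    × ((φ : Ty) → IsNF φ → Closed (⟨ [] ⟩⇒ φ) ⇔ Closed (⟨ [] ⟩⇒ (ω ⇒ φ)))
    × ((n m : ℕ) → 1 ≤ n →  (Γs : Fin m → Ctx) (φs : Fin m → Ty) →
      (∀ i → InC (Γs i)) → (∀ i → IsNF (φs i)) →
      (∀ i → Closed (⟨ Γs i ⟩⇒ φs i)) →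
      (∀ i j → i ≢ j → ∀ β → ¬ (β ∈TV (⟨ Γs i ⟩⇒ φs i) × β ∈TV (⟨ Γs j ⟩⇒ φs j))) →
      (α : TVar) → (∀ i → ¬ (α ∈TV (⟨ Γs i ⟩⇒ φs i))) →
      Closed (⟨ meetAll (ω^ (n ∸ 1) ∙ (ty (arrows (tabulate φs) (var α)) ∷ [])) (tabulate Γs) ⟩⇒ var α))
lemma3p9 =
    (λ Γ v φ _ _ _ → closed-∷⇔closed-⇒ Γ v φ)
  , (λ φ _ → mk⇔ id id)
  , (λ n m _ Γs φs _ _ → appType-closed (n ∸ 1) Γs φs)
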